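{- Let $a$ be an odd positive integer, let $k,m\ge0$ be integers and let $n$ be a positive integer with $n\equiv k+\frac{a-1}2\pmod 2$. Then $$t(a,3a,8k+4,4m+2;n)=\frac23\,N(a,3a,8k+4,4m+2;\,8n+4m+8k+4a+6).$$
   Context: For positive integers $a,b,c,d$ and an integer $n\ge 0$, $N(a,b,c,d;n)$ denotes the number of $(x,y,z,w)\in\mathbb Z^4$ with $n=ax^2+by^2+cz^2+dw^2$, and $t(a,b,c,d;n)$ denotes the number of $(x,y,z,w)\in\mathbb Z^4$ with $n=a\frac{x(x-1)}2+b\frac{y(y-1)}2+c\frac{z(z-1)}2+d\frac{w(w-1)}2$. -}

module Defs where

open import Data.Nat using (ℕ; zero; suc)
import Data.Nat
open import Data.Integer using (ℤ; +_; -[1+_]; _+_; _*_; _-_)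
import Data.Integer as ℤ
open import Data.List using (List; []; _∷_; _++_; length; filter; cartesianProduct; map)
open import Data.Product using (_×_; _,_)
open import Relation.Binary.PropositionalEquality using (_≡_)

intRange : ℕ → List ℤ
intRange zero = + 0 ∷ []
intRange (suc B) = + (suc B) ∷ -[1+ B ] ∷ intRange B

quads : ℕ → List (ℤ × ℤ × ℤ × ℤ)
quads B = cartesianProduct R (cartesianProduct R (cartesianProduct R R))
  where R = intRange B

sqSum : ℕ → ℕ → ℕ → ℕ → ℤ × ℤ × ℤ × ℤ → ℤ
sqSum a b c d (x , y , z , w) =
  + a * (x * x) + + b * (y * y) + + c * (z * z) + + d * (w * w)

-- twice the generalized-triangular sum: a x(x-1) + b y(y-1) + ...
triSum2 : ℕ → ℕ → ℕ → ℕ → ℤ × ℤ × ℤ × ℤ → ℤ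
triSum2 a b c d (x , y , z , w) =
  + a * (x * (x - + 1)) + + b * (y * (y - + 1))
  + + c * (z * (z - + 1)) + + d * (w * (w - + 1))

-- N(a,b,c,d;n) = #{(x,y,z,w) ∈ ℤ⁴ : n = ax²+by²+cz²+dw²}.
-- For positive a,b,c,d every solution has |x|,|y|,|z|,|w| ≤ n, so
-- enumerating the box [-n,n]^4 counts all of them.
N : ℕ → ℕ → ℕ → ℕ → ℕ → ℕ
N a b c d n = length (filter (λ v → sqSum a b c d v ℤ.≟ + n) (quads n))

-- t(a,b,c,d;n) = #{(x,y,z,w) ∈ ℤ⁴ : n = a x(x-1)/2 + ... }, written
-- equivalently as 2n = a x(x-1) + ... .  Every solution has all
-- coordinates in [-(n+1), n+1].
t : ℕ → ℕ → ℕ → ℕ → ℕ → ℕ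
t a b c d n =
  length (filter (λ v → triSum2 a b c d v ℤ.≟ + (2 Data.Nat.* n)) (quads (suc n)))

module Submission where

-- Write a = 2a′ + 1; the parity hypothesis says n + k + a′ = 2e, so M = 16e + 4m + 10.
-- Split the solutions of  a X² + 3a Y² + c Z² + d W² = M  (c = 8k+4, d = 4m+2) into the
-- odd ones (X odd) and the even ones (X even).
--  * Reducing the equation modulo 2, 4, 8 and 16 shows that an odd solution has all
--    coordinates odd, and an even one is (2x, 2y, Z, W) with x + y odd.
--  * Since (2x - 1)² = 4·x(x - 1) + 1, the map x ↦ 2x - 1 in every coordinate is a bijection
--    from the solutions counted by t onto the odd solutions.
--  * The "turns" (x, y) ↦ (x + 3y, y - x) and (x, y) ↦ (x - 3y, x + y) keep X² + 3Y² at
--    (2x, 2y) fixed; together they map the even solutions two-to-one onto the odd ones.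
-- Hence t = #odd = 2 · #even and N = #odd + #even = 3 · #even, so 3t = 2N.

open import Defs
open import Data.Bool using (Bool; true; false)
open import Data.Empty using (⊥-elim)
open import Data.List using (List; []; _∷_; length; map; filter; cartesianProduct)
open import Data.List.Membership.Propositional using (_∈_)
open import Data.List.Relation.Unary.All as All using ()
open import Data.List.Relation.Unary.AllPairs using ([]; _∷_)
open import Data.List.Relation.Unary.Any using (here; there)
open import Data.List.Relation.Unary.Unique.Propositional using (Unique)
open import Data.Product using (Σ; _×_; _,_; proj₁; proj₂; map₁; map₂)
open import Data.Product.Properties using (,-injective)
open import Data.Sum using (_⊎_; inj₁; inj₂)
open import Function using (_∘_)
open import Function.Bundles using (_⇔_; mk⇔; Equivalence)
open import Relation.Nullary using (¬_; Dec; yes; no; ¬?)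
open import Relation.Unary using (Decidable)
open import Relation.Binary.PropositionalEquality using (_≡_; _≢_; refl; sym; trans; cong; cong₂; subst; module ≡-Reasoning)
import Data.Nat as ℕ
import Data.Nat.Properties as ℕ
open import Data.Integer using (ℤ)

-- Counting elements of duplicate-free lists.
module Counting where

  open import Data.Nat using (suc; _+_; _*_)
  open import Data.Nat.Properties using (+-suc)
  open import Data.List.Properties using (length-map)
  open import Data.List.Membership.Propositional.Properties using (∈-map⁺; ∈-map⁻)
  open import Data.List.Membership.Propositional.Properties.WithK using (unique∧set⇒bag)
  open import Data.List.Relation.Binary.BagAndSetEquality using (∼bag⇒↭)
  open import Data.List.Relation.Binary.Permutation.Propositional.Properties using (↭-length)

  unique-map : ∀ {A B : Set} (f : A → B) {xs : List A} → Unique xs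
    → (∀ {x y} → x ∈ xs → y ∈ xs → f x ≡ f y → x ≡ y) → Unique (map f xs)
  unique-map f {[]} [] inj = []
  unique-map f {x ∷ xs} (x∉xs ∷ u) inj =
    All.tabulate fx∉ ∷ unique-map f u (λ p q → inj (there p) (there q))
    where
    fx∉ : ∀ {z} → z ∈ map f xs → f x ≢ z
    fx∉ z∈ fx≡z with ∈-map⁻ f z∈
    ... | y , y∈xs , refl = All.lookup x∉xs y∈xs (inj (here refl) (there y∈xs) fx≡z)

  -- Counting by bijection: if f is injective on the members of xs and maps them
  -- onto exactly the members of ys, duplicate-free lists xs and ys have equal length
  -- (map f xs and ys are duplicate-free with the same members, hence permutations).
  length-bijection : ∀ {A B : Set} (f : A → B) {xs : List A} {ys : List B}
    → Unique xs → Unique ys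
    → (∀ {x y} → x ∈ xs → y ∈ xs → f x ≡ f y → x ≡ y)
    → (∀ {x} → x ∈ xs → f x ∈ ys)
    → (∀ {y} → y ∈ ys → Σ A λ x → x ∈ xs × f x ≡ y)
    → length xs ≡ length ys
  length-bijection f {xs} {ys} uxs uys inj into onto =
    trans (sym (length-map f xs)) (↭-length (∼bag⇒↭ (unique∧set⇒bag (unique-map f uxs inj) uys sameMembers)))
    where
    sameMembers : ∀ {y} → (y ∈ map f xs) ⇔ (y ∈ ys)
    sameMembers = mk⇔ to from
      where
      to : ∀ {y} → y ∈ map f xs → y ∈ ys
      to y∈ with ∈-map⁻ f y∈
      ... | x , x∈xs , refl = into x∈xs
      from : ∀ {y} → y ∈ ys → y ∈ map f xs
      from y∈ with onto y∈
      ... | x , x∈xs , refl = ∈-map⁺ f x∈xs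

  length-filter-split : ∀ {A : Set} {P : A → Set} (P? : Decidable P) (xs : List A)
    → length xs ≡ length (filter P? xs) + length (filter (¬? ∘ P?) xs)
  length-filter-split P? [] = refl
  length-filter-split P? (x ∷ xs) with P? x
  ... | yes _ = cong suc (length-filter-split P? xs)
  ... | no _ = trans (cong suc (length-filter-split P? xs)) (sym (+-suc _ _))

  length-tagged : ∀ {A : Set} (xs : List A) → length (cartesianProduct xs (true ∷ false ∷ [])) ≡ length xs * 2
  length-tagged [] = refl
  length-tagged (x ∷ xs) = cong (λ l → suc (suc l)) (length-tagged xs)

-- Parity, halving and residues of integers.
module IntegerFacts where

  open import Data.Integer using (ℤ; +_; -[1+_]; +[1+_]; _+_; _*_; _-_; -_)
  open import Data.Integer.Properties using (+-injective; pos-+; pos-*; *-zeroʳ; +-0-abelianGroup)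
  open import Data.Integer.Tactic.RingSolver using (solve-∀)
  open import Algebra.Bundles using (AbelianGroup)
  open import Algebra.Properties.Group (AbelianGroup.group +-0-abelianGroup) using (∙-cancelʳ)
  open import Relation.Nullary.Decidable using (True; False; toWitness; toWitnessFalse)
  open ≡-Reasoning

  Even Odd : ℤ → Set
  Even x = Σ ℤ λ u → x ≡ u + u
  Odd x = Σ ℤ λ u → x ≡ u + u + + 1

  private
    parityℕ : ∀ n → (Σ ℕ.ℕ λ j → n ≡ j ℕ.+ j) ⊎ (Σ ℕ.ℕ λ j → n ≡ ℕ.suc (j ℕ.+ j))
    parityℕ ℕ.zero = inj₁ (0 , refl)
    parityℕ (ℕ.suc n) with parityℕ n
    ... | inj₁ (j , refl) = inj₂ (j , refl)
    ... | inj₂ (j , refl) = inj₁ (ℕ.suc j , cong ℕ.suc (sym (ℕ.+-suc j j)))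

    even-neg : ∀ {x} → Even x → Even (- x)
    even-neg (u , refl) = - u , negate u
      where
      negate : ∀ u → - (u + u) ≡ - u + - u
      negate = solve-∀

    odd-neg : ∀ {x} → Odd x → Odd (- x)
    odd-neg (u , refl) = - u - + 1 , negate u
      where
      negate : ∀ u → - (u + u + + 1) ≡ - u - + 1 + (- u - + 1) + + 1
      negate = solve-∀

    parity-pos : ∀ n → Even (+ n) ⊎ Odd (+ n)
    parity-pos n with parityℕ n
    ... | inj₁ (j , refl) = inj₁ (+ j , pos-+ j j)
    ... | inj₂ (j , refl) = inj₂ (+ j , trans (cong +_ (ℕ.+-comm 1 (j ℕ.+ j)))
                                            (trans (pos-+ (j ℕ.+ j) 1) (cong (_+ + 1) (pos-+ j j))))

  parity : ∀ x → Even x ⊎ Odd x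
  parity (+ n) = parity-pos n
  parity -[1+ n ] with parity-pos (ℕ.suc n)
  ... | inj₁ ev = inj₁ (even-neg ev)
  ... | inj₂ od = inj₂ (odd-neg od)

  half : ℤ → ℤ
  half (+ n) = + ℕ.⌊ n /2⌋
  half -[1+ n ] = -[1+ ℕ.⌊ n /2⌋ ]

  half-double : ∀ u → half (u + u) ≡ u
  half-double (+ n) = cong +_ (sym (ℕ.n≡⌊n+n/2⌋ n))
  half-double -[1+ n ] = cong -[1+_] (sym (ℕ.n≡⌈n+n/2⌉ n))

  double-injective : ∀ {u v} → u + u ≡ v + v → u ≡ v
  double-injective {u} {v} eq = trans (sym (half-double u)) (trans (cong half eq) (half-double v))

  odd-square : ∀ {x} → Odd x → Σ ℤ λ p → x * x ≡ + 8 * p + + 1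
  odd-square (u , refl) with parity u
  ... | inj₁ (w , refl) = w * (w + w) + w , expand w
    where
    expand : ∀ w → (w + w + (w + w) + + 1) * (w + w + (w + w) + + 1) ≡ + 8 * (w * (w + w) + w) + + 1
    expand = solve-∀
  ... | inj₂ (w , refl) = w * (w + w) + + 3 * w + + 1 , expand w
    where
    expand : ∀ w → (w + w + + 1 + (w + w + + 1) + + 1) * (w + w + + 1 + (w + w + + 1) + + 1)
                 ≡ + 8 * (w * (w + w) + + 3 * w + + 1) + + 1
    expand = solve-∀

  even-square : ∀ u {x} → x ≡ u + u → x * x ≡ + 4 * (u * u)
  even-square u refl = expand u
    where
    expand : ∀ u → (u + u) * (u + u) ≡ + 4 * (u * u)
    expand = solve-∀

  private
    -- A multiple of K plus a residue r < K equals a residue s < K only when r = s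
    -- (a positive multiple would make s ≥ K; a negative one is the mirrored case).
    residue-of-multiple : ∀ K {r s} u → r ℕ.< K → s ℕ.< K → + K * u + + r ≡ + s → r ≡ s
    residue-of-multiple K {r} (+ 0) _ _ eq = +-injective (trans (cong (_+ + r) (sym (*-zeroʳ (+ K)))) eq)
    residue-of-multiple K {r} {s} +[1+ j ] _ s<K eq = ⊥-elim (ℕ.<⇒≱ s<K K≤s)
      where
      K≤s : K ℕ.≤ s
      K≤s = ℕ.≤-trans (ℕ.m≤m*n K (ℕ.suc j)) (ℕ.≤-trans (ℕ.m≤m+n _ r)
              (ℕ.≤-reflexive (+-injective (trans (cong (_+ + r) (pos-* K (ℕ.suc j))) eq))))
    residue-of-multiple K {r} {s} -[1+ j ] r<K s<K eq =
      sym (residue-of-multiple K +[1+ j ] s<K r<K (trans (cong (λ w → + K * +[1+ j ] + w) (sym eq)) (cancel (+ K) -[1+ j ] (+ r))))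
      where
      cancel : ∀ k u r → k * (- u) + (k * u + r) ≡ r
      cancel = solve-∀

  residue-clash : ∀ K r s {r<K : True (r ℕ.<? K)} {s<K : True (s ℕ.<? K)} {r≢s : False (r ℕ.≟ s)}
    (u v t : ℤ) {lhs rhs : ℤ} → lhs ≡ + K * u + + r + t → rhs ≡ + K * v + + s + t → lhs ≢ rhs
  residue-clash K r s {r<K} {s<K} {r≢s} u v t lhs≡ rhs≡ eq =
    toWitnessFalse r≢s (residue-of-multiple K (u - v) (toWitness r<K) (toWitness s<K) shifted)
    where
    cancelled : + K * u + + r ≡ + K * v + + s
    cancelled = ∙-cancelʳ t _ _ (trans (sym lhs≡) (trans eq rhs≡))
    shift : ∀ k u v r → k * (u - v) + r ≡ k * u + r - k * v
    shift = solve-∀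
    unshift : ∀ k v s → k * v + s - k * v ≡ s
    unshift = solve-∀
    shifted : + K * (u - v) + + r ≡ + s
    shifted = begin
      + K * (u - v) + + r       ≡⟨ shift (+ K) u v (+ r) ⟩
      + K * u + + r - + K * v   ≡⟨ cong (_- + K * v) cancelled ⟩
      + K * v + + s - + K * v   ≡⟨ unshift (+ K) v (+ s) ⟩
      + s                       ∎

  even⇒¬odd : ∀ {x} → Even x → ¬ Odd x
  even⇒¬odd (u , refl) (v , eq) = residue-clash 2 0 1 u v (+ 0) (twice u) (twice-plus-one v) eq
    where
    twice : ∀ u → u + u ≡ + 2 * u + + 0 + + 0
    twice = solve-∀
    twice-plus-one : ∀ v → v + v + + 1 ≡ + 2 * v + + 1 + + 0
    twice-plus-one = solve-∀

  odd? : ∀ x → Dec (Odd x)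
  odd? x with parity x
  ... | inj₁ ev = no (even⇒¬odd ev)
  ... | inj₂ od = yes od

-- The search boxes of Defs: quads B enumerates [-B, B]⁴ without repetition, and every
-- solution of either equation lies in the box that Defs searches.
module Enumeration where

  open import Data.Nat using (ℕ; suc; _≤_; z≤n; s≤s)
  open import Data.Integer using (ℤ; +_; -[1+_]; +[1+_]; ∣_∣; _+_; _*_; _-_)
  open import Data.Integer.Properties using (+-injective; pos-*)
  open import Data.List.Membership.Propositional.Properties using (∈-cartesianProduct⁺)
  open import Data.List.Relation.Unary.Unique.Propositional.Properties using (cartesianProduct⁺)

  intRange-sound : ∀ B {x} → x ∈ intRange B → ∣ x ∣ ≤ B
  intRange-sound ℕ.zero (here refl) = z≤n
  intRange-sound (suc B) (here refl) = ℕ.≤-refl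
  intRange-sound (suc B) (there (here refl)) = ℕ.≤-refl
  intRange-sound (suc B) (there (there x∈)) = ℕ.m≤n⇒m≤1+n (intRange-sound B x∈)

  intRange-complete : ∀ B {x} → ∣ x ∣ ≤ B → x ∈ intRange B
  intRange-complete ℕ.zero {+ ℕ.zero} _ = here refl
  intRange-complete (suc B) {+ j} j≤B with ℕ.m≤n⇒m<n∨m≡n j≤B
  ... | inj₂ refl = here refl
  ... | inj₁ (s≤s j≤B′) = there (there (intRange-complete B j≤B′))
  intRange-complete (suc B) { -[1+ j ]} (s≤s j≤B) with ℕ.m≤n⇒m<n∨m≡n j≤B
  ... | inj₂ refl = there (here refl)
  ... | inj₁ j<B = there (there (intRange-complete B j<B))

  intRange-unique : ∀ B → Unique (intRange B)
  intRange-unique ℕ.zero = All.[] ∷ []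
  intRange-unique (suc B) = All.tabulate top-new ∷ All.tabulate bottom-new ∷ intRange-unique B
    where
    outside : ∀ {x} → x ∈ intRange B → ∣ x ∣ ≢ suc B
    outside x∈ eq = ℕ.n≮n B (subst (_≤ B) eq (intRange-sound B x∈))
    top-new : ∀ {x} → x ∈ -[1+ B ] ∷ intRange B → + suc B ≢ x
    top-new (here refl) ()
    top-new (there x∈) refl = outside x∈ refl
    bottom-new : ∀ {x} → x ∈ intRange B → -[1+ B ] ≢ x
    bottom-new x∈ refl = outside x∈ refl

  quads-unique : ∀ B → Unique (quads B)
  quads-unique B = cartesianProduct⁺ R (cartesianProduct⁺ R (cartesianProduct⁺ R R))
    where R = intRange-unique B

  quads-complete : ∀ B {X Y Z W} → ∣ X ∣ ≤ B → ∣ Y ∣ ≤ B → ∣ Z ∣ ≤ B → ∣ W ∣ ≤ B → (X , Y , Z , W) ∈ quads B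
  quads-complete B bX bY bZ bW = ∈-cartesianProduct⁺ (intRange-complete B bX)
    (∈-cartesianProduct⁺ (intRange-complete B bY) (∈-cartesianProduct⁺ (intRange-complete B bZ) (intRange-complete B bW)))

  square-ℕ : ∀ x → x * x ≡ + (∣ x ∣ ℕ.* ∣ x ∣)
  square-ℕ (+ j) = sym (pos-* j j)
  square-ℕ -[1+ j ] = refl

  pronic : ℤ → ℕ
  pronic (+ ℕ.zero) = 0
  pronic +[1+ j ] = suc j ℕ.* j
  pronic -[1+ j ] = suc j ℕ.* suc (suc j)

  pronic-ℕ : ∀ x → x * (x - + 1) ≡ + pronic x
  pronic-ℕ (+ ℕ.zero) = refl
  pronic-ℕ +[1+ j ] = sym (pos-* (suc j) j)
  pronic-ℕ -[1+ j ] = cong (λ i → + (suc j ℕ.* suc (suc i))) (ℕ.+-identityʳ j)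

  weighted-ℕ : (f : ℤ → ℤ) (g : ℤ → ℕ) → (∀ x → f x ≡ + g x) → ∀ a b c d X Y Z W
    → + a * f X + + b * f Y + + c * f Z + + d * f W ≡ + (a ℕ.* g X ℕ.+ b ℕ.* g Y ℕ.+ c ℕ.* g Z ℕ.+ d ℕ.* g W)
  weighted-ℕ f g f≡g a b c d X Y Z W
    rewrite f≡g X | f≡g Y | f≡g Z | f≡g W
          | sym (pos-* a (g X)) | sym (pos-* b (g Y)) | sym (pos-* c (g Z)) | sym (pos-* d (g W)) = refl

  sum-in-box : (g : ℤ → ℕ) {B T : ℕ} → (∀ {w} x → 0 ℕ.< w → w ℕ.* g x ≤ T → ∣ x ∣ ≤ B)
    → ∀ {a b c d X Y Z W} → 0 ℕ.< a → 0 ℕ.< b → 0 ℕ.< c → 0 ℕ.< d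
    → a ℕ.* g X ℕ.+ b ℕ.* g Y ℕ.+ c ℕ.* g Z ℕ.+ d ℕ.* g W ≡ T → (X , Y , Z , W) ∈ quads B
  sum-in-box g small {a} {b} {c} {d} {X} {Y} {Z} {W} pa pb pc pd refl =
    quads-complete _ (small X pa first) (small Y pb second) (small Z pc third) (small W pd fourth)
    where
    A = a ℕ.* g X
    B = b ℕ.* g Y
    C = c ℕ.* g Z
    D = d ℕ.* g W
    first : A ≤ A ℕ.+ B ℕ.+ C ℕ.+ D
    first = ℕ.m≤n⇒m≤n+o D (ℕ.m≤n⇒m≤n+o C (ℕ.m≤m+n A B))
    second : B ≤ A ℕ.+ B ℕ.+ C ℕ.+ D
    second = ℕ.m≤n⇒m≤n+o D (ℕ.m≤n⇒m≤n+o C (ℕ.m≤n+m B A))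
    third : C ≤ A ℕ.+ B ℕ.+ C ℕ.+ D
    third = ℕ.m≤n⇒m≤n+o D (ℕ.m≤n+m C (A ℕ.+ B))
    fourth : D ≤ A ℕ.+ B ℕ.+ C ℕ.+ D
    fourth = ℕ.m≤n+m D (A ℕ.+ B ℕ.+ C)

  private
    n≤n*n : ∀ n → n ≤ n ℕ.* n
    n≤n*n ℕ.zero = z≤n
    n≤n*n (suc n) = ℕ.m≤m*n (suc n) (suc n)

    pronic-size : ∀ x → 2 ℕ.* (∣ x ∣ ℕ.∸ 1) ≤ pronic x
    pronic-size (+ ℕ.zero) = z≤n
    pronic-size +[1+ j ] = ℕ.+-monoʳ-≤ j (ℕ.≤-trans (ℕ.≤-reflexive (ℕ.+-identityʳ j)) (n≤n*n j))
    pronic-size -[1+ j ] = ℕ.≤-trans (ℕ.≤-reflexive (ℕ.*-comm 2 j))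
                             (ℕ.≤-trans (ℕ.*-monoʳ-≤ j (s≤s (s≤s z≤n))) (ℕ.m≤n+m _ _))

  solution-in-box : ∀ {a b c d M v} → 0 ℕ.< a → 0 ℕ.< b → 0 ℕ.< c → 0 ℕ.< d
    → sqSum a b c d v ≡ + M → v ∈ quads M
  solution-in-box {a} {b} {c} {d} {M} {X , Y , Z , W} pa pb pc pd eq =
    sum-in-box (λ x → ∣ x ∣ ℕ.* ∣ x ∣) square-size pa pb pc pd
      (+-injective (trans (sym (weighted-ℕ (λ x → x * x) (λ x → ∣ x ∣ ℕ.* ∣ x ∣) square-ℕ a b c d X Y Z W)) eq))
    where
    square-size : ∀ {w} x → 0 ℕ.< w → w ℕ.* (∣ x ∣ ℕ.* ∣ x ∣) ≤ M → ∣ x ∣ ≤ M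
    square-size {w} x pw bound = ℕ.≤-trans (n≤n*n ∣ x ∣) (ℕ.≤-trans (ℕ.m≤n*m _ w {{ℕ.>-nonZero pw}}) bound)

  tri-solution-in-box : ∀ {a b c d n v} → 0 ℕ.< a → 0 ℕ.< b → 0 ℕ.< c → 0 ℕ.< d
    → triSum2 a b c d v ≡ + (2 ℕ.* n) → v ∈ quads (suc n)
  tri-solution-in-box {a} {b} {c} {d} {n} {X , Y , Z , W} pa pb pc pd eq =
    sum-in-box pronic pronic-bound pa pb pc pd
      (+-injective (trans (sym (weighted-ℕ (λ x → x * (x - + 1)) pronic pronic-ℕ a b c d X Y Z W)) eq))
    where
    pronic-bound : ∀ {w} x → 0 ℕ.< w → w ℕ.* pronic x ≤ 2 ℕ.* n → ∣ x ∣ ≤ suc n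
    pronic-bound {w} x pw bound = ℕ.≤-trans (ℕ.m≤n+m∸n ∣ x ∣ 1) (s≤s (ℕ.*-cancelˡ-≤ 2
      (ℕ.≤-trans (pronic-size x) (ℕ.≤-trans (ℕ.m≤n*m _ w {{ℕ.>-nonZero pw}}) bound))))

-- Algebraic identities behind the two bijections.
module FormIdentities where

  open import Data.Integer using (ℤ; +_; _+_; _*_; _-_; -_)
  open import Data.Integer.Properties using (pos-*; *-cancelˡ-≡; +-0-abelianGroup)
  open import Data.Integer.Tactic.RingSolver using (solve-∀)
  open import Algebra.Bundles using (AbelianGroup)
  open import Algebra.Properties.Group (AbelianGroup.group +-0-abelianGroup) using (∙-cancelʳ)
  open IntegerFacts
  open ≡-Reasoning

  oddShift : ℤ × ℤ × ℤ × ℤ → ℤ × ℤ × ℤ × ℤ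
  oddShift (x , y , z , w) = x + x - + 1 , y + y - + 1 , z + z - + 1 , w + w - + 1

  -- Since (2x - 1)² = 4·x(x - 1) + 1, the square form at oddShift v is four times
  -- the triangular form at v plus the sum of the coefficients.
  sqSum-oddShift : ∀ a b c d v → sqSum a b c d (oddShift v) ≡ + 4 * triSum2 a b c d v + + (a ℕ.+ b ℕ.+ c ℕ.+ d)
  sqSum-oddShift a b c d (x , y , z , w) = expand (+ a) (+ b) (+ c) (+ d) x y z w
    where
    expand : ∀ A B C D x y z w
      → A * ((x + x - + 1) * (x + x - + 1)) + B * ((y + y - + 1) * (y + y - + 1))
        + C * ((z + z - + 1) * (z + z - + 1)) + D * ((w + w - + 1) * (w + w - + 1))
      ≡ + 4 * (A * (x * (x - + 1)) + B * (y * (y - + 1)) + C * (z * (z - + 1)) + D * (w * (w - + 1)))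
        + (A + B + C + D)
    expand = solve-∀

  shift-equation : ∀ a b c d n v
    → triSum2 a b c d v ≡ + (2 ℕ.* n) ⇔ sqSum a b c d (oddShift v) ≡ + (4 ℕ.* (2 ℕ.* n) ℕ.+ (a ℕ.+ b ℕ.+ c ℕ.+ d))
  shift-equation a b c d n v = mk⇔ to from
    where
    σ target : ℤ
    σ = + (a ℕ.+ b ℕ.+ c ℕ.+ d)
    target = + (4 ℕ.* (2 ℕ.* n) ℕ.+ (a ℕ.+ b ℕ.+ c ℕ.+ d))
    scale : + 4 * + (2 ℕ.* n) + σ ≡ target
    scale = cong (_+ σ) (sym (pos-* 4 (2 ℕ.* n)))
    to : triSum2 a b c d v ≡ + (2 ℕ.* n) → sqSum a b c d (oddShift v) ≡ target
    to eq = trans (sqSum-oddShift a b c d v) (trans (cong (λ t → + 4 * t + σ) eq) scale)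
    from : sqSum a b c d (oddShift v) ≡ target → triSum2 a b c d v ≡ + (2 ℕ.* n)
    from eq = *-cancelˡ-≡ (+ 4) _ _ (∙-cancelʳ σ _ _ (trans (sym (sqSum-oddShift a b c d v)) (trans eq (sym scale))))

  private
    shift-injective : ∀ x y → x + x - + 1 ≡ y + y - + 1 → x ≡ y
    shift-injective x y eq = double-injective (∙-cancelʳ (- + 1) _ _ eq)

  oddShift-injective : ∀ {v v′} → oddShift v ≡ oddShift v′ → v ≡ v′
  oddShift-injective {x , y , z , w} {x′ , y′ , z′ , w′} eq
    with ,-injective eq
  ... | ex , eq′ with ,-injective eq′
  ... | ey , eq″ with ,-injective eq″
  ... | ez , ew
    with shift-injective x x′ ex | shift-injective y y′ ey | shift-injective z z′ ez | shift-injective w w′ ew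
  ... | refl | refl | refl | refl = refl

  odd-shifted : ∀ {X} → Odd X → Σ ℤ λ u → u + u - + 1 ≡ X
  odd-shifted (x , refl) = x + + 1 , expand x
    where
    expand : ∀ x → x + + 1 + (x + + 1) - + 1 ≡ x + x + + 1
    expand = solve-∀

  shift-odd : ∀ x → Odd (x + x - + 1)
  shift-odd x = x - + 1 , expand x
    where
    expand : ∀ x → x + x - + 1 ≡ x - + 1 + (x - + 1) + + 1
    expand = solve-∀

  oddShift-onto : ∀ {X Y Z W} → Odd X → Odd Y → Odd Z → Odd W → Σ (ℤ × ℤ × ℤ × ℤ) λ v → oddShift v ≡ (X , Y , Z , W)
  oddShift-onto oX oY oZ oW with odd-shifted oX | odd-shifted oY | odd-shifted oZ | odd-shifted oW
  ... | x , refl | y , refl | z , refl | w , refl = (x , y , z , w) , refl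

  -- The two "turns" (x, y) ↦ (x + 3y, y - x) and (x, y) ↦ (x - 3y, x + y); they take
  -- the value of X² + 3Y² at the even pair (2x, 2y) to the same value.
  turn : Bool → ℤ → ℤ → ℤ × ℤ
  turn true x y = x + + 3 * y , y - x
  turn false x y = x - + 3 * y , x + y

  private
    turn-identity : ∀ b A B C D x y s t → B ≡ + 3 * A
      → A * (proj₁ (turn b x y) * proj₁ (turn b x y)) + B * (proj₂ (turn b x y) * proj₂ (turn b x y)) + C * s + D * t
      ≡ A * ((x + x) * (x + x)) + B * ((y + y) * (y + y)) + C * s + D * t
    turn-identity true A _ C D x y s t refl = expand A C D x y s t
      where
      expand : ∀ A C D x y s t
        → A * ((x + + 3 * y) * (x + + 3 * y)) + + 3 * A * ((y - x) * (y - x)) + C * s + D * t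
        ≡ A * ((x + x) * (x + x)) + + 3 * A * ((y + y) * (y + y)) + C * s + D * t
      expand = solve-∀
    turn-identity false A _ C D x y s t refl = expand A C D x y s t
      where
      expand : ∀ A C D x y s t
        → A * ((x - + 3 * y) * (x - + 3 * y)) + + 3 * A * ((x + y) * (x + y)) + C * s + D * t
        ≡ A * ((x + x) * (x + x)) + + 3 * A * ((y + y) * (y + y)) + C * s + D * t
      expand = solve-∀

  sqSum-turn : ∀ b a c d x y z w
    → sqSum a (3 ℕ.* a) c d (proj₁ (turn b x y) , proj₂ (turn b x y) , z , w) ≡ sqSum a (3 ℕ.* a) c d (x + x , y + y , z , w)
  sqSum-turn b a c d x y z w = turn-identity b (+ a) (+ (3 ℕ.* a)) (+ c) (+ d) x y (z * z) (w * w) (pos-* 3 a)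

  turn-odd : ∀ b {x y} → Odd (x + y) → Odd (proj₁ (turn b x y))
  turn-odd true {x} {y} (t , x+y≡2t+1) = t + y , (begin
    x + + 3 * y             ≡⟨ regroup x y ⟩
    x + y + (y + y)         ≡⟨ cong (_+ (y + y)) x+y≡2t+1 ⟩
    t + t + + 1 + (y + y)   ≡⟨ collect t y ⟩
    t + y + (t + y) + + 1   ∎)
    where
    regroup : ∀ x y → x + + 3 * y ≡ x + y + (y + y)
    regroup = solve-∀
    collect : ∀ t y → t + t + + 1 + (y + y) ≡ t + y + (t + y) + + 1
    collect = solve-∀
  turn-odd false {x} {y} (t , x+y≡2t+1) = t - y - y , (begin
    x - + 3 * y                 ≡⟨ regroup x y ⟩
    x + y - + 4 * y             ≡⟨ cong (_- + 4 * y) x+y≡2t+1 ⟩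
    t + t + + 1 - + 4 * y       ≡⟨ collect t y ⟩
    t - y - y + (t - y - y) + + 1 ∎)
    where
    regroup : ∀ x y → x - + 3 * y ≡ x + y - + 4 * y
    regroup = solve-∀
    collect : ∀ t y → t + t + + 1 - + 4 * y ≡ t - y - y + (t - y - y) + + 1
    collect = solve-∀

  private
    -- Four times the inverse of each turn.
    untwist : Bool → ℤ × ℤ → ℤ × ℤ
    untwist true (P , Q) = P - + 3 * Q , P + Q
    untwist false (P , Q) = P + + 3 * Q , Q - P

    untwist-turn : ∀ b x y → untwist b (turn b x y) ≡ (+ 4 * x , + 4 * y)
    untwist-turn true x y = cong₂ _,_ (expand₁ x y) (expand₂ x y)
      where
      expand₁ : ∀ x y → x + + 3 * y - + 3 * (y - x) ≡ + 4 * x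
      expand₁ = solve-∀
      expand₂ : ∀ x y → x + + 3 * y + (y - x) ≡ + 4 * y
      expand₂ = solve-∀
    untwist-turn false x y = cong₂ _,_ (expand₁ x y) (expand₂ x y)
      where
      expand₁ : ∀ x y → x - + 3 * y + + 3 * (x + y) ≡ + 4 * x
      expand₁ = solve-∀
      expand₂ : ∀ x y → x + y - (x - + 3 * y) ≡ + 4 * y
      expand₂ = solve-∀

    turn-cancel : ∀ b {x y x′ y′} → turn b x y ≡ turn b x′ y′ → x ≡ x′ × y ≡ y′
    turn-cancel b {x} {y} {x′} {y′} eq with ,-injective (trans (sym (untwist-turn b x y)) (trans (cong (untwist b) eq) (untwist-turn b x′ y′)))
    ... | 4x≡4x′ , 4y≡4y′ = *-cancelˡ-≡ (+ 4) x x′ 4x≡4x′ , *-cancelˡ-≡ (+ 4) y y′ 4y≡4y′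

    -- The two turns have no common value on pairs with x + y odd: otherwise x + y = -2y′.
    true≢false : ∀ {x y x′ y′} → Odd (x + y) → turn true x y ≢ turn false x′ y′
    true≢false {x} {y} {x′} {y′} oxy eq = even⇒¬odd (- y′ , *-cancelˡ-≡ (+ 2) _ _ doubled) oxy
      where
      expand₁ : ∀ x y → + 2 * (x + y) ≡ x + + 3 * y - (y - x)
      expand₁ = solve-∀
      expand₂ : ∀ x′ y′ → x′ - + 3 * y′ - (x′ + y′) ≡ + 2 * (- y′ + - y′)
      expand₂ = solve-∀
      doubled : + 2 * (x + y) ≡ + 2 * (- y′ + - y′)
      doubled = begin
        + 2 * (x + y)               ≡⟨ expand₁ x y ⟩
        x + + 3 * y - (y - x)       ≡⟨ cong₂ _-_ (cong proj₁ eq) (cong proj₂ eq) ⟩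
        x′ - + 3 * y′ - (x′ + y′)   ≡⟨ expand₂ x′ y′ ⟩
        + 2 * (- y′ + - y′)         ∎

  turn-injective : ∀ b b′ {x y x′ y′} → Odd (x + y) → Odd (x′ + y′)
    → turn b x y ≡ turn b′ x′ y′ → b ≡ b′ × x ≡ x′ × y ≡ y′
  turn-injective true true _ _ eq = refl , turn-cancel true eq
  turn-injective false false _ _ eq = refl , turn-cancel false eq
  turn-injective true false {x} {y} {x′} {y′} oxy _ eq = ⊥-elim (true≢false {x} {y} {x′} {y′} oxy eq)
  turn-injective false true {x} {y} {x′} {y′} _ oxy′ eq = ⊥-elim (true≢false {x′} {y′} {x} {y} oxy′ (sym eq))

  private
    unshift : ∀ p q → p + q - q + (p + q - q) + + 1 ≡ p + p + + 1
    unshift = solve-∀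

  -- Every pair of odd numbers is a turn of some (x, y): writing P = 2p + 1, Q = 2q + 1,
  -- the first turn applies when p + q is odd, the second when it is even.
  turn-onto : ∀ {P Q} → Odd P → Odd Q → Σ Bool λ b → Σ ℤ λ x → Σ ℤ λ y → turn b x y ≡ (P , Q)
  turn-onto (p , refl) (q , refl) with parity (p + q)
  ... | inj₂ (r , p+q≡2r+1) = true , r - q - q , r + + 1 , cong₂ _,_ first (second r q)
    where
    second : ∀ r q → r + + 1 - (r - q - q) ≡ q + q + + 1
    second = solve-∀
    first : r - q - q + + 3 * (r + + 1) ≡ p + p + + 1
    first = begin
      r - q - q + + 3 * (r + + 1)                 ≡⟨ regroup r q ⟩
      r + r + + 1 - q + (r + r + + 1 - q) + + 1   ≡⟨ cong (λ s → s - q + (s - q) + + 1) (sym p+q≡2r+1) ⟩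
      p + q - q + (p + q - q) + + 1               ≡⟨ unshift p q ⟩
      p + p + + 1                                 ∎
      where
      regroup : ∀ r q → r - q - q + + 3 * (r + + 1) ≡ r + r + + 1 - q + (r + r + + 1 - q) + + 1
      regroup = solve-∀
  ... | inj₁ (r , p+q≡2r) = false , q + r + + 1 , q - r , cong₂ _,_ first (second r q)
    where
    second : ∀ r q → q + r + + 1 + (q - r) ≡ q + q + + 1
    second = solve-∀
    first : q + r + + 1 - + 3 * (q - r) ≡ p + p + + 1
    first = begin
      q + r + + 1 - + 3 * (q - r)         ≡⟨ regroup r q ⟩
      r + r - q + (r + r - q) + + 1       ≡⟨ cong (λ s → s - q + (s - q) + + 1) (sym p+q≡2r) ⟩
      p + q - q + (p + q - q) + + 1       ≡⟨ unshift p q ⟩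
      p + p + + 1                         ∎
      where
      regroup : ∀ r q → q + r + + 1 - + 3 * (q - r) ≡ r + r - q + (r + r - q) + + 1
      regroup = solve-∀

-- The congruence analysis of a X² + 3a Y² + c Z² + d W² = 16ε + 4μ + 10.  Each step
-- substitutes the shapes 8p + 1 (odd) or 4q (even) for the squares and compares
-- residues; the polynomial identities are stated for all values and proved by the
-- ring solver.
module SolutionParity (α κ μ ε : ℤ) where

  open import Data.Integer using (ℤ; +_; _+_; _*_; _-_)
  open import Data.Integer.Tactic.RingSolver using (solve-∀)
  open IntegerFacts

  -- Sol s₁ s₂ s₃ s₄: the equation  a s₁ + 3a s₂ + c s₃ + d s₄ = 16ε + 4μ + 10  with
  -- a = 2α + 1, c = 8κ + 4, d = 4μ + 2, to be evaluated at the squares of a solution.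
  Sol : ℤ → ℤ → ℤ → ℤ → Set
  Sol s₁ s₂ s₃ s₄ =
    (+ 2 * α + + 1) * s₁ + + 3 * (+ 2 * α + + 1) * s₂ + (+ 8 * κ + + 4) * s₃ + (+ 4 * μ + + 2) * s₄
      ≡ + 16 * ε + + 4 * μ + + 10

  Sol-cong : ∀ {s₁ s₂ s₃ s₄ s₁′ s₂′ s₃′ s₄′} → s₁ ≡ s₁′ → s₂ ≡ s₂′ → s₃ ≡ s₃′ → s₄ ≡ s₄′
    → Sol s₁ s₂ s₃ s₄ → Sol s₁′ s₂′ s₃′ s₄′
  Sol-cong refl refl refl refl h = h

  private
    rhs-mod-2 : ∀ ε μ → + 16 * ε + + 4 * μ + + 10 ≡ + 2 * (+ 8 * ε + + 2 * μ + + 5) + + 0 + + 0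
    rhs-mod-2 = solve-∀
    rhs-mod-4 : ∀ ε μ → + 16 * ε + + 4 * μ + + 10 ≡ + 4 * (+ 4 * ε + μ + + 2) + + 2 + + 0
    rhs-mod-4 = solve-∀
    rhs-mod-8 : ∀ ε μ → + 16 * ε + + 4 * μ + + 10 ≡ + 8 * (+ 2 * ε + + 1) + + 2 + + 4 * μ
    rhs-mod-8 = solve-∀
    rhs-mod-16 : ∀ ε μ → + 16 * ε + + 4 * μ + + 10 ≡ + 16 * ε + + 10 + + 4 * μ
    rhs-mod-16 = solve-∀

    even-sum-square : ∀ x y t → x + y ≡ t + t → (x + x) * (x + x) ≡ + 4 * ((t + t - y) * (t + t - y))
    even-sum-square x y t x+y≡2t = trans (even-square x refl) (cong (λ r → + 4 * (r * r)) x≡2t-y)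
      where
      cancel : ∀ x y → x ≡ x + y - y
      cancel = solve-∀
      x≡2t-y : x ≡ t + t - y
      x≡2t-y = trans (cancel x y) (cong (_- y) x+y≡2t)

  -- Modulo 2: X and Y have the same parity.
  odd-even-clash : ∀ p q s₃ s₄ → ¬ Sol (+ 8 * p + + 1) (+ 4 * q) s₃ s₄
  odd-even-clash p q s₃ s₄ = residue-clash 2 1 0
    (+ 4 * (+ 2 * α + + 1) * p + α + + 6 * (+ 2 * α + + 1) * q + (+ 4 * κ + + 2) * s₃ + (+ 2 * μ + + 1) * s₄)
    (+ 8 * ε + + 2 * μ + + 5) (+ 0) (expand α κ μ p q s₃ s₄) (rhs-mod-2 ε μ)
    where
    expand : ∀ α κ μ p q s₃ s₄
      → (+ 2 * α + + 1) * (+ 8 * p + + 1) + + 3 * (+ 2 * α + + 1) * (+ 4 * q) + (+ 8 * κ + + 4) * s₃ + (+ 4 * μ + + 2) * s₄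
      ≡ + 2 * (+ 4 * (+ 2 * α + + 1) * p + α + + 6 * (+ 2 * α + + 1) * q + (+ 4 * κ + + 2) * s₃ + (+ 2 * μ + + 1) * s₄)
        + + 1 + + 0
    expand = solve-∀

  even-odd-clash : ∀ p q s₃ s₄ → ¬ Sol (+ 4 * p) (+ 8 * q + + 1) s₃ s₄
  even-odd-clash p q s₃ s₄ = residue-clash 2 1 0
    (+ 2 * (+ 2 * α + + 1) * p + + 12 * (+ 2 * α + + 1) * q + + 3 * α + + 1 + (+ 4 * κ + + 2) * s₃ + (+ 2 * μ + + 1) * s₄)
    (+ 8 * ε + + 2 * μ + + 5) (+ 0) (expand α κ μ p q s₃ s₄) (rhs-mod-2 ε μ)
    where
    expand : ∀ α κ μ p q s₃ s₄
      → (+ 2 * α + + 1) * (+ 4 * p) + + 3 * (+ 2 * α + + 1) * (+ 8 * q + + 1) + (+ 8 * κ + + 4) * s₃ + (+ 4 * μ + + 2) * s₄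
      ≡ + 2 * (+ 2 * (+ 2 * α + + 1) * p + + 12 * (+ 2 * α + + 1) * q + + 3 * α + + 1 + (+ 4 * κ + + 2) * s₃
               + (+ 2 * μ + + 1) * s₄) + + 1 + + 0
    expand = solve-∀

  -- Modulo 4: W is odd (when X and Y are both odd or both even).
  odd-odd-even-clash : ∀ p q s₃ w → ¬ Sol (+ 8 * p + + 1) (+ 8 * q + + 1) s₃ (+ 4 * w)
  odd-odd-even-clash p q s₃ w = residue-clash 4 0 2
    ((+ 2 * α + + 1) * (+ 2 * p + + 6 * q + + 1) + (+ 2 * κ + + 1) * s₃ + (+ 4 * μ + + 2) * w)
    (+ 4 * ε + μ + + 2) (+ 0) (expand α κ μ p q s₃ w) (rhs-mod-4 ε μ)
    where
    expand : ∀ α κ μ p q s₃ w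
      → (+ 2 * α + + 1) * (+ 8 * p + + 1) + + 3 * (+ 2 * α + + 1) * (+ 8 * q + + 1) + (+ 8 * κ + + 4) * s₃
        + (+ 4 * μ + + 2) * (+ 4 * w)
      ≡ + 4 * ((+ 2 * α + + 1) * (+ 2 * p + + 6 * q + + 1) + (+ 2 * κ + + 1) * s₃ + (+ 4 * μ + + 2) * w) + + 0 + + 0
    expand = solve-∀

  even-even-even-clash : ∀ p q s₃ w → ¬ Sol (+ 4 * p) (+ 4 * q) s₃ (+ 4 * w)
  even-even-even-clash p q s₃ w = residue-clash 4 0 2
    ((+ 2 * α + + 1) * p + + 3 * (+ 2 * α + + 1) * q + (+ 2 * κ + + 1) * s₃ + (+ 4 * μ + + 2) * w)
    (+ 4 * ε + μ + + 2) (+ 0) (expand α κ μ p q s₃ w) (rhs-mod-4 ε μ)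
    where
    expand : ∀ α κ μ p q s₃ w
      → (+ 2 * α + + 1) * (+ 4 * p) + + 3 * (+ 2 * α + + 1) * (+ 4 * q) + (+ 8 * κ + + 4) * s₃ + (+ 4 * μ + + 2) * (+ 4 * w)
      ≡ + 4 * ((+ 2 * α + + 1) * p + + 3 * (+ 2 * α + + 1) * q + (+ 2 * κ + + 1) * s₃ + (+ 4 * μ + + 2) * w) + + 0 + + 0
    expand = solve-∀

  -- Modulo 8: when X, Y, W are odd, so is Z.
  odd-odd-even-odd-clash : ∀ p q z w → ¬ Sol (+ 8 * p + + 1) (+ 8 * q + + 1) (+ 4 * z) (+ 8 * w + + 1)
  odd-odd-even-odd-clash p q z w = residue-clash 8 6 2
    ((+ 2 * α + + 1) * p + + 3 * (+ 2 * α + + 1) * q + α + (+ 4 * κ + + 2) * z + (+ 4 * μ + + 2) * w)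
    (+ 2 * ε + + 1) (+ 4 * μ) (expand α κ μ p q z w) (rhs-mod-8 ε μ)
    where
    expand : ∀ α κ μ p q z w
      → (+ 2 * α + + 1) * (+ 8 * p + + 1) + + 3 * (+ 2 * α + + 1) * (+ 8 * q + + 1) + (+ 8 * κ + + 4) * (+ 4 * z)
        + (+ 4 * μ + + 2) * (+ 8 * w + + 1)
      ≡ + 8 * ((+ 2 * α + + 1) * p + + 3 * (+ 2 * α + + 1) * q + α + (+ 4 * κ + + 2) * z + (+ 4 * μ + + 2) * w)
        + + 6 + + 4 * μ
    expand = solve-∀

  -- Modulo 8 and 16: for X = 2x, Y = 2y and odd W, the sum x + y is odd.
  -- Here x + y = 2t is excluded, writing x = 2t - y.
  even-sum-odd-clash : ∀ t y z w
    → ¬ Sol (+ 4 * ((t + t - y) * (t + t - y))) (+ 4 * (y * y)) (+ 8 * z + + 1) (+ 8 * w + + 1)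
  even-sum-odd-clash t y z w = residue-clash 8 6 2
    (+ 2 * (+ 2 * α + + 1) * (t * t - t * y + y * y) + + 8 * κ * z + κ + + 4 * z + (+ 4 * μ + + 2) * w)
    (+ 2 * ε + + 1) (+ 4 * μ) (expand α κ μ t y z w) (rhs-mod-8 ε μ)
    where
    expand : ∀ α κ μ t y z w
      → (+ 2 * α + + 1) * (+ 4 * ((t + t - y) * (t + t - y))) + + 3 * (+ 2 * α + + 1) * (+ 4 * (y * y))
        + (+ 8 * κ + + 4) * (+ 8 * z + + 1) + (+ 4 * μ + + 2) * (+ 8 * w + + 1)
      ≡ + 8 * (+ 2 * (+ 2 * α + + 1) * (t * t - t * y + y * y) + + 8 * κ * z + κ + + 4 * z + (+ 4 * μ + + 2) * w)
        + + 6 + + 4 * μ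
    expand = solve-∀

  even-sum-even-clash : ∀ t y z w
    → ¬ Sol (+ 4 * ((t + t - y) * (t + t - y))) (+ 4 * (y * y)) (+ 4 * z) (+ 8 * w + + 1)
  even-sum-even-clash t y z w = residue-clash 16 2 10
    ((+ 2 * α + + 1) * (t * t - t * y + y * y) + (+ 2 * κ + + 1) * z + (+ 2 * μ + + 1) * w)
    ε (+ 4 * μ) (expand α κ μ t y z w) (rhs-mod-16 ε μ)
    where
    expand : ∀ α κ μ t y z w
      → (+ 2 * α + + 1) * (+ 4 * ((t + t - y) * (t + t - y))) + + 3 * (+ 2 * α + + 1) * (+ 4 * (y * y))
        + (+ 8 * κ + + 4) * (+ 4 * z) + (+ 4 * μ + + 2) * (+ 8 * w + + 1)
      ≡ + 16 * ((+ 2 * α + + 1) * (t * t - t * y + y * y) + (+ 2 * κ + + 1) * z + (+ 2 * μ + + 1) * w)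
        + + 2 + + 4 * μ
    expand = solve-∀

  odd-solution : ∀ {X Y Z W} → Sol (X * X) (Y * Y) (Z * Z) (W * W) → Odd X → Odd Y × Odd Z × Odd W
  odd-solution {X} {Y} {Z} {W} h oX with odd-square oX | parity Y
  ... | p , eX | inj₁ (y , eY) =
    ⊥-elim (odd-even-clash p (y * y) (Z * Z) (W * W) (Sol-cong eX (even-square y eY) refl refl h))
  ... | p , eX | inj₂ oY with odd-square oY | parity W
  ...   | q , eY | inj₁ (w , eW) =
    ⊥-elim (odd-odd-even-clash p q (Z * Z) (w * w) (Sol-cong eX eY refl (even-square w eW) h))
  ...   | q , eY | inj₂ oW with odd-square oW | parity Z
  ...     | s , eW | inj₁ (z , eZ) =
    ⊥-elim (odd-odd-even-odd-clash p q (z * z) s (Sol-cong eX eY (even-square z eZ) eW h))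
  ...     | s , eW | inj₂ oZ = oY , oZ , oW

  even-solution : ∀ {x Y Z W} → Sol ((x + x) * (x + x)) (Y * Y) (Z * Z) (W * W) → Σ ℤ λ y → Y ≡ y + y × Odd (x + y)
  even-solution {x} {Y} {Z} {W} h with parity Y
  ... | inj₂ oY with odd-square oY
  ...   | q , eY = ⊥-elim (even-odd-clash (x * x) q (Z * Z) (W * W) (Sol-cong (even-square x refl) eY refl refl h))
  even-solution {x} {Y} {Z} {W} h | inj₁ (y , refl) with parity W
  ... | inj₁ (w , eW) = ⊥-elim (even-even-even-clash (x * x) (y * y) (Z * Z) (w * w)
                          (Sol-cong (even-square x refl) (even-square y refl) refl (even-square w eW) h))
  ... | inj₂ oW with odd-square oW | parity (x + y)
  ...   | _ | inj₂ oxy = y , refl , oxy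
  ...   | s , eW | inj₁ (t , x+y≡2t) with parity Z
  ...     | inj₁ (z , eZ) = ⊥-elim (even-sum-even-clash t y (z * z) s
                              (Sol-cong (even-sum-square x y t x+y≡2t) (even-square y refl) (even-square z eZ) eW h))
  ...     | inj₂ oZ with odd-square oZ
  ...       | r , eZ = ⊥-elim (even-sum-odd-clash t y r s
                              (Sol-cong (even-sum-square x y t x+y≡2t) (even-square y refl) eZ eW h))

-- The count for a = 2a′ + 1, c = 8k + 4, d = 4m + 2, given n + k + a′ = 2e.
module Count (a′ k m n e : ℕ.ℕ) (n+k+a′≡2e : n ℕ.+ k ℕ.+ a′ ≡ e ℕ.+ e) where

  open import Data.Integer using (ℤ; +_; _+_; _*_; _≟_)
  open import Data.Integer.Properties using (pos-+; pos-*)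
  open import Data.List.Membership.Propositional.Properties
    using (∈-filter⁺; ∈-filter⁻; ∈-cartesianProduct⁺; ∈-cartesianProduct⁻)
  open import Data.List.Relation.Unary.Unique.Propositional.Properties using (filter⁺; cartesianProduct⁺)
  open Counting
  open IntegerFacts
  open Enumeration
  open FormIdentities
  open SolutionParity (+ a′) (+ k) (+ m) (+ e)

  a c d M : ℕ.ℕ
  a = 2 ℕ.* a′ ℕ.+ 1
  c = 8 ℕ.* k ℕ.+ 4
  d = 4 ℕ.* m ℕ.+ 2
  M = 8 ℕ.* n ℕ.+ 4 ℕ.* m ℕ.+ 8 ℕ.* k ℕ.+ 4 ℕ.* a ℕ.+ 6

  V : Set
  V = ℤ × ℤ × ℤ × ℤ

  Solves TriSolves : V → Set
  Solves v = sqSum a (3 ℕ.* a) c d v ≡ + M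
  TriSolves v = triSum2 a (3 ℕ.* a) c d v ≡ + (2 ℕ.* n)

  -- These facts are kept abstract:
  -- their proofs are ring-solver certificates, which with-abstraction over terms
  -- containing them would otherwise unfold.
  abstract
    M≡16e+4m+10 : + M ≡ + 16 * + e + + 4 * + m + + 10
    M≡16e+4m+10 = begin
      + M                                     ≡⟨ cong +_ (regroup a′ k m n) ⟩
      + (8 ℕ.* (n ℕ.+ k ℕ.+ a′) ℕ.+ 4 ℕ.* m ℕ.+ 10)  ≡⟨ cong (λ s → + (8 ℕ.* s ℕ.+ 4 ℕ.* m ℕ.+ 10)) n+k+a′≡2e ⟩
      + (8 ℕ.* (e ℕ.+ e) ℕ.+ 4 ℕ.* m ℕ.+ 10)         ≡⟨ cong +_ (collect e m) ⟩
      + (16 ℕ.* e ℕ.+ 4 ℕ.* m ℕ.+ 10)                ≡⟨ cong (_+ + 10) (trans (pos-+ (16 ℕ.* e) (4 ℕ.* m)) (cong₂ _+_ (pos-* 16 e) (pos-* 4 m))) ⟩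
      + 16 * + e + + 4 * + m + + 10            ∎
      where
      open ≡-Reasoning
      open import Data.Nat.Tactic.RingSolver using (solve-∀)
      regroup : ∀ a′ k m n → 8 ℕ.* n ℕ.+ 4 ℕ.* m ℕ.+ 8 ℕ.* k ℕ.+ 4 ℕ.* (2 ℕ.* a′ ℕ.+ 1) ℕ.+ 6
                           ≡ 8 ℕ.* (n ℕ.+ k ℕ.+ a′) ℕ.+ 4 ℕ.* m ℕ.+ 10
      regroup = solve-∀
      collect : ∀ e m → 8 ℕ.* (e ℕ.+ e) ℕ.+ 4 ℕ.* m ℕ.+ 10 ≡ 16 ℕ.* e ℕ.+ 4 ℕ.* m ℕ.+ 10
      collect = solve-∀

    M≡8n+coefficients : M ≡ 4 ℕ.* (2 ℕ.* n) ℕ.+ (a ℕ.+ 3 ℕ.* a ℕ.+ c ℕ.+ d)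
    M≡8n+coefficients = regroup a′ k m n
      where
      open import Data.Nat.Tactic.RingSolver using (solve-∀)
      regroup : ∀ a′ k m n → 8 ℕ.* n ℕ.+ 4 ℕ.* m ℕ.+ 8 ℕ.* k ℕ.+ 4 ℕ.* (2 ℕ.* a′ ℕ.+ 1) ℕ.+ 6
        ≡ 4 ℕ.* (2 ℕ.* n) ℕ.+ ((2 ℕ.* a′ ℕ.+ 1) ℕ.+ 3 ℕ.* (2 ℕ.* a′ ℕ.+ 1) ℕ.+ (8 ℕ.* k ℕ.+ 4) ℕ.+ (4 ℕ.* m ℕ.+ 2))
      regroup = solve-∀

    solution⇔Sol : ∀ X Y Z W → Solves (X , Y , Z , W) ⇔ Sol (X * X) (Y * Y) (Z * Z) (W * W)
    solution⇔Sol X Y Z W = mk⇔ (λ eq → trans (sym coefficients) (trans eq M≡16e+4m+10))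
                                       (λ sol → trans coefficients (trans sol (sym M≡16e+4m+10)))
      where
      affine : ∀ p q r → + (p ℕ.* q ℕ.+ r) ≡ + p * + q + + r
      affine p q r = trans (pos-+ (p ℕ.* q) r) (cong (_+ + r) (pos-* p q))
      weights : ∀ {A A′ B B′ C C′ D D′ : ℤ} → A ≡ A′ → B ≡ B′ → C ≡ C′ → D ≡ D′
        → A * (X * X) + B * (Y * Y) + C * (Z * Z) + D * (W * W) ≡ A′ * (X * X) + B′ * (Y * Y) + C′ * (Z * Z) + D′ * (W * W)
      weights refl refl refl refl = refl
      coefficients : sqSum a (3 ℕ.* a) c d (X , Y , Z , W)
        ≡ (+ 2 * + a′ + + 1) * (X * X) + + 3 * (+ 2 * + a′ + + 1) * (Y * Y) + (+ 8 * + k + + 4) * (Z * Z) + (+ 4 * + m + + 2) * (W * W)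
      coefficients = weights (affine 2 a′ 1) (trans (pos-* 3 a) (cong (+ 3 *_) (affine 2 a′ 1))) (affine 8 k 4) (affine 4 m 2)

  shifted-solution : ∀ v → TriSolves v ⇔ Solves (oddShift v)
  shifted-solution v = subst (λ K → TriSolves v ⇔ sqSum a (3 ℕ.* a) c d (oddShift v) ≡ + K)
    (sym M≡8n+coefficients) (shift-equation a (3 ℕ.* a) c d n v)

  OddSolution EvenSolution : V → Set
  OddSolution u = Solves u × Odd (proj₁ u)
  EvenSolution v = Solves v × ¬ Odd (proj₁ v)

  odd-preimage : ∀ {u} → OddSolution u → Σ V λ v → TriSolves v × oddShift v ≡ u
  odd-preimage {X , Y , Z , W} (sol , oX) with odd-solution {X} {Y} {Z} {W} (Equivalence.to (solution⇔Sol X Y Z W) sol) oX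
  ... | oY , oZ , oW with oddShift-onto oX oY oZ oW
  ... | v , shifted = v , Equivalence.from (shifted-solution v) (subst Solves (sym shifted) sol) , shifted

  even-shape : ∀ {X Y Z W} → EvenSolution (X , Y , Z , W)
    → Σ ℤ λ x → Σ ℤ λ y → X ≡ x + x × Y ≡ y + y × Odd (x + y)
  even-shape {X} {Y} {Z} {W} (sol , ¬oX) with parity X
  ... | inj₂ oX = ⊥-elim (¬oX oX)
  ... | inj₁ (x , refl) with even-solution {x} {Y} {Z} {W} (Equivalence.to (solution⇔Sol (x + x) Y Z W) sol)
  ... | y , Y≡2y , oxy = x , y , refl , Y≡2y , oxy

  rotate : V × Bool → V
  rotate ((X , Y , Z , W) , b) = proj₁ (turn b (half X) (half Y)) , proj₂ (turn b (half X) (half Y)) , Z , W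

  rotate-even : ∀ b x y Z W → rotate ((x + x , y + y , Z , W) , b) ≡ (proj₁ (turn b x y) , proj₂ (turn b x y) , Z , W)
  rotate-even b x y Z W rewrite half-double x | half-double y = refl

  rotate-even-solution : ∀ {vb} → EvenSolution (proj₁ vb) → OddSolution (rotate vb)
  rotate-even-solution {(X , Y , Z , W) , b} (sol , ¬oX) with even-shape {X} {Y} {Z} {W} (sol , ¬oX)
  ... | x , y , refl , refl , oxy = subst OddSolution (sym (rotate-even b x y Z W))
                                      (trans (sqSum-turn b a c d x y Z W) sol , turn-odd b oxy)

  rotate-injective : ∀ {vb vb′} → EvenSolution (proj₁ vb) → EvenSolution (proj₁ vb′) → rotate vb ≡ rotate vb′ → vb ≡ vb′
  rotate-injective {(X , Y , Z , W) , b} {(X′ , Y′ , Z′ , W′) , b′} even even′ eq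
    with even-shape {X} {Y} {Z} {W} even | even-shape {X′} {Y′} {Z′} {W′} even′
  ... | x , y , refl , refl , oxy | x′ , y′ , refl , refl , oxy′
    with ,-injective (trans (sym (rotate-even b x y Z W)) (trans eq (rotate-even b′ x′ y′ Z′ W′)))
  ... | eP , eQZW with ,-injective eQZW
  ... | eQ , eZW with ,-injective eZW
  ... | refl , refl with turn-injective b b′ oxy oxy′ (cong₂ _,_ eP eQ)
  ... | refl , refl , refl = refl

  rotate-onto : ∀ {u} → OddSolution u → Σ (V × Bool) λ vb → EvenSolution (proj₁ vb) × rotate vb ≡ u
  rotate-onto {P , Q , Z , W} (sol , oP) with odd-solution {P} {Q} {Z} {W} (Equivalence.to (solution⇔Sol P Q Z W) sol) oP
  ... | oQ , _ with turn-onto oP oQ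
  ... | b , x , y , turned = ((x + x , y + y , Z , W) , b) , (unturned , even⇒¬odd (x , refl)) ,
                             trans (rotate-even b x y Z W) (cong (λ t → proj₁ t , proj₂ t , Z , W) turned)
    where
    unturned : Solves (x + x , y + y , Z , W)
    unturned = trans (sym (sqSum-turn b a c d x y Z W))
                 (trans (cong (λ t → sqSum a (3 ℕ.* a) c d (proj₁ t , proj₂ t , Z , W)) turned) sol)

  positive-a : 0 ℕ.< a
  positive-a = ℕ.m≤n+m 1 (2 ℕ.* a′)
  positive-3a : 0 ℕ.< 3 ℕ.* a
  positive-3a = ℕ.<-≤-trans positive-a (ℕ.m≤m+n a (2 ℕ.* a))
  positive-c : 0 ℕ.< c
  positive-c = ℕ.<-≤-trans (ℕ.s≤s ℕ.z≤n) (ℕ.m≤n+m 4 (8 ℕ.* k))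
  positive-d : 0 ℕ.< d
  positive-d = ℕ.<-≤-trans (ℕ.s≤s ℕ.z≤n) (ℕ.m≤n+m 2 (4 ℕ.* m))

  solution? : Decidable Solves
  solution? v = sqSum a (3 ℕ.* a) c d v ≟ + M

  tri-solution? : Decidable TriSolves
  tri-solution? v = triSum2 a (3 ℕ.* a) c d v ≟ + (2 ℕ.* n)

  first-odd? : Decidable (λ (v : V) → Odd (proj₁ v))
  first-odd? v = odd? (proj₁ v)

  S T Od Ev : List V
  S = filter solution? (quads M)
  T = filter tri-solution? (quads (ℕ.suc n))
  Od = filter first-odd? S
  Ev = filter (¬? ∘ first-odd?) S

  unique-S : Unique S
  unique-S = filter⁺ solution? (quads-unique M)

  T⇒TriSolves : ∀ {v} → v ∈ T → TriSolves v
  T⇒TriSolves v∈T = proj₂ (∈-filter⁻ tri-solution? {xs = quads (ℕ.suc n)} v∈T)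

  TriSolves⇒T : ∀ {v} → TriSolves v → v ∈ T
  TriSolves⇒T sol = ∈-filter⁺ tri-solution? (tri-solution-in-box positive-a positive-3a positive-c positive-d sol) sol

  Solves⇒S : ∀ {v} → Solves v → v ∈ S
  Solves⇒S sol = ∈-filter⁺ solution? (solution-in-box positive-a positive-3a positive-c positive-d sol) sol

  Od⇒OddSolution : ∀ {u} → u ∈ Od → OddSolution u
  Od⇒OddSolution u∈Od = map₁ (λ u∈S → proj₂ (∈-filter⁻ solution? {xs = quads M} u∈S)) (∈-filter⁻ first-odd? {xs = S} u∈Od)

  OddSolution⇒Od : ∀ {u} → OddSolution u → u ∈ Od
  OddSolution⇒Od (sol , oX) = ∈-filter⁺ first-odd? (Solves⇒S sol) oX

  Ev⇒EvenSolution : ∀ {v} → v ∈ Ev → EvenSolution v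
  Ev⇒EvenSolution v∈Ev = map₁ (λ v∈S → proj₂ (∈-filter⁻ solution? {xs = quads M} v∈S)) (∈-filter⁻ (¬? ∘ first-odd?) {xs = S} v∈Ev)

  EvenSolution⇒Ev : ∀ {v} → EvenSolution v → v ∈ Ev
  EvenSolution⇒Ev (sol , ¬oX) = ∈-filter⁺ (¬? ∘ first-odd?) (Solves⇒S sol) ¬oX

  |T|≡|Od| : length T ≡ length Od
  |T|≡|Od| = length-bijection oddShift (filter⁺ tri-solution? (quads-unique (ℕ.suc n))) (filter⁺ first-odd? unique-S)
    (λ {v} {v′} _ _ → oddShift-injective {v} {v′}) into onto
    where
    into : ∀ {v} → v ∈ T → oddShift v ∈ Od
    into {v} v∈T = OddSolution⇒Od (Equivalence.to (shifted-solution v) (T⇒TriSolves v∈T) , shift-odd (proj₁ v))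
    onto : ∀ {u} → u ∈ Od → Σ V λ v → v ∈ T × oddShift v ≡ u
    onto u∈Od = map₂ (map₁ TriSolves⇒T) (odd-preimage (Od⇒OddSolution u∈Od))

  bits : List Bool
  bits = true ∷ false ∷ []

  |Ev×bits|≡|Od| : length (cartesianProduct Ev bits) ≡ length Od
  |Ev×bits|≡|Od| = length-bijection rotate (cartesianProduct⁺ (filter⁺ (¬? ∘ first-odd?) unique-S) unique-bits)
    (filter⁺ first-odd? unique-S) injective into onto
    where
    unique-bits : Unique bits
    unique-bits = ((λ ()) All.∷ All.[]) ∷ All.[] ∷ []
    all-bits : ∀ b → b ∈ bits
    all-bits true = here refl
    all-bits false = there (here refl)
    even : ∀ {vb} → vb ∈ cartesianProduct Ev bits → EvenSolution (proj₁ vb)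
    even vb∈ = Ev⇒EvenSolution (proj₁ (∈-cartesianProduct⁻ Ev bits vb∈))
    into : ∀ {vb} → vb ∈ cartesianProduct Ev bits → rotate vb ∈ Od
    into {vb} vb∈ = OddSolution⇒Od (rotate-even-solution {vb} (even vb∈))
    injective : ∀ {vb vb′} → vb ∈ cartesianProduct Ev bits → vb′ ∈ cartesianProduct Ev bits → rotate vb ≡ rotate vb′ → vb ≡ vb′
    injective {vb} {vb′} vb∈ vb′∈ = rotate-injective {vb} {vb′} (even vb∈) (even vb′∈)
    onto : ∀ {u} → u ∈ Od → Σ (V × Bool) λ vb → vb ∈ cartesianProduct Ev bits × rotate vb ≡ u
    onto u∈Od = map₂ (λ {vb} → map₁ (λ ev → ∈-cartesianProduct⁺ (EvenSolution⇒Ev ev) (all-bits (proj₂ vb))))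
                  (rotate-onto (Od⇒OddSolution u∈Od))

  |Od|≡2|Ev| : length Od ≡ 2 ℕ.* length Ev
  |Od|≡2|Ev| = trans (sym |Ev×bits|≡|Od|) (trans (length-tagged Ev) (ℕ.*-comm (length Ev) 2))

  count : 3 ℕ.* t a (3 ℕ.* a) c d n ≡ 2 ℕ.* N a (3 ℕ.* a) c d M
  count = begin
    3 ℕ.* length T                            ≡⟨ cong (3 ℕ.*_) (trans |T|≡|Od| |Od|≡2|Ev|) ⟩
    3 ℕ.* (2 ℕ.* length Ev)                   ≡⟨ regroup (length Ev) ⟩
    2 ℕ.* (2 ℕ.* length Ev ℕ.+ length Ev)     ≡⟨ cong (λ l → 2 ℕ.* (l ℕ.+ length Ev)) (sym |Od|≡2|Ev|) ⟩
    2 ℕ.* (length Od ℕ.+ length Ev)           ≡⟨ cong (2 ℕ.*_) (sym (length-filter-split first-odd? S)) ⟩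
    2 ℕ.* length S                            ∎
    where
    open ≡-Reasoning
    open import Data.Nat.Tactic.RingSolver using (solve-∀)
    regroup : ∀ l → 3 ℕ.* (2 ℕ.* l) ≡ 2 ℕ.* (2 ℕ.* l ℕ.+ l)
    regroup = solve-∀

open import Data.Nat using (ℕ; _+_; _*_; _∸_; _/_; _%_; _<_)
open import Data.Nat.Properties using (+-assoc; *-comm; m+n∸n≡m)
open import Data.Nat.DivMod using (m≡m%n+[m/n]*n; m*n/n≡m)
open import Data.Nat.Tactic.RingSolver using (solve-∀)

odd-as-double : ∀ a → a % 2 ≡ 1 → Σ ℕ λ q → a ≡ 2 * q + 1
odd-as-double a a%2≡1 = a / 2 , (begin
  a                   ≡⟨ m≡m%n+[m/n]*n a 2 ⟩
  a % 2 + a / 2 * 2   ≡⟨ cong (_+ a / 2 * 2) a%2≡1 ⟩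
  1 + a / 2 * 2       ≡⟨ regroup (a / 2) ⟩
  2 * (a / 2) + 1     ∎)
  where
  open ≡-Reasoning
  regroup : ∀ q → 1 + q * 2 ≡ 2 * q + 1
  regroup = solve-∀

equal-parity : ∀ x y → x % 2 ≡ y % 2 → Σ ℕ λ e → x + y ≡ e + e
equal-parity x y same = x % 2 + x / 2 + y / 2 , (begin
  x + y                                     ≡⟨ cong₂ _+_ (m≡m%n+[m/n]*n x 2) (m≡m%n+[m/n]*n y 2) ⟩
  x % 2 + x / 2 * 2 + (y % 2 + y / 2 * 2)   ≡⟨ cong (λ r → x % 2 + x / 2 * 2 + (r + y / 2 * 2)) (sym same) ⟩
  x % 2 + x / 2 * 2 + (x % 2 + y / 2 * 2)   ≡⟨ regroup (x % 2) (x / 2) (y / 2) ⟩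
  x % 2 + x / 2 + y / 2 + (x % 2 + x / 2 + y / 2) ∎)
  where
  open ≡-Reasoning
  regroup : ∀ r p q → r + p * 2 + (r + q * 2) ≡ r + p + q + (r + p + q)
  regroup = solve-∀

half-predecessor : ∀ q → (2 * q + 1 ∸ 1) / 2 ≡ q
half-predecessor q = trans (cong (_/ 2) (trans (m+n∸n≡m (2 * q) 1) (*-comm 2 q))) (m*n/n≡m q 2)

-- Theorem 2.4.
theorem2p4 : (a k m n : ℕ) → 0 < a → a % 2 ≡ 1 → 0 < n
    → n % 2 ≡ (k + (a ∸ 1) / 2) % 2
    → 3 * t a (3 * a) (8 * k + 4) (4 * m + 2) n
      ≡ 2 * N a (3 * a) (8 * k + 4) (4 * m + 2) (8 * n + 4 * m + 8 * k + 4 * a + 6)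
theorem2p4 a k m n _ a-odd _ n-parity with odd-as-double a a-odd
... | a′ , refl with equal-parity n (k + a′) (trans n-parity (cong (λ h → (k + h) % 2) (half-predecessor a′)))
... | e , n+[k+a′]≡2e = Count.count a′ k m n e (trans (+-assoc n k a′) n+[k+a′]≡2e)
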